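{- For every $n\in\mathbb{N}$, there exists a convex geometric graph with $n$ vertices and $O(n^{3/2})$ edges that is universal for $\mathcal{O}_2(n)$.
   Context: A geometric graph is a graph together with a straight-line drawing in the plane in which the vertices are distinct points and the edges are straight-line segments not containing any vertex in their interiors; it is convex if its vertices are in convex position. An embedding of an abstract graph $H$ into a geometric graph $G$ is an injective map $\phi:V(H)\to V(G)$ such that every edge $uv$ of $H$ is mapped to a segment $\phi(u)\phi(v)$ that is an edge of $G$, and any two edges of $H$ are mapped to non-crossing segments. A geometric graph is universal for a class $\mathcal H$ if it contains an embedding of every graph in $\mathcal H$. $\mathcal{O}_2(n)$ denotes the family of all outerplanar graphs on $n$ vertices that consist of a spanning (Hamiltonian) cycle plus $2$ vertex-disjoint chords. -}

module Defs where

open import Data.Nat using (ℕ; zero; suc; _<_; _≤_; _*_; _^_)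
open import Data.Fin using (Fin; toℕ)
open import Data.Bool using (Bool; true; false)
open import Data.List using (List; length; filter; allFin; cartesianProduct)
open import Data.Product using (Σ; _×_; _,_; proj₁; proj₂; ∃; ∃-syntax)
open import Data.Sum using (_⊎_)
open import Relation.Nullary using (¬_; Dec)
open import Relation.Binary.PropositionalEquality using (_≡_; _≢_)
open import Data.Bool using (T)
open import Relation.Nullary.Decidable using (T?)
open import Function.Definitions using (Injective)

record Graph (n : ℕ) : Set where
  field
    adj   : Fin n → Fin n → Bool
    sym   : ∀ u v → adj u v ≡ adj v u
    irrefl : ∀ u → adj u u ≡ false

open Graph public

Edge : ∀ {n} → Graph n → Fin n → Fin n → Set
Edge G u v = adj G u v ≡ true

numEdges : ∀ {n} → Graph n → ℕ
numEdges {n} G = length (filter (λ p → T? (isEdgeLt p)) (cartesianProduct (allFin n) (allFin n)))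
  where
    open import Data.Nat using (_<ᵇ_)
    open import Data.Bool using (_∧_)
    isEdgeLt : Fin n × Fin n → Bool
    isEdgeLt (i , j) = (toℕ i <ᵇ toℕ j) ∧ adj G i j

-- Convex position: a convex geometric graph on n vertices is modelled by
-- placing vertex i at the i-th corner (in cyclic order) of a convex n-gon.
-- For points in convex position, two segments cross iff their four
-- endpoints are distinct and interleave in the cyclic order.
Between : ℕ → ℕ → ℕ → Set
Between x y z = (x < y × y < z) ⊎ (z < y × y < x)

Cross : ∀ {n} → Fin n → Fin n → Fin n → Fin n → Set
Cross a b c d =
  a ≢ c × a ≢ d × b ≢ c × b ≢ d ×
  ((Between (toℕ a) (toℕ c) (toℕ b) × ¬ Between (toℕ a) (toℕ d) (toℕ b)) ⊎
   (Between (toℕ a) (toℕ d) (toℕ b) × ¬ Between (toℕ a) (toℕ c) (toℕ b)))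

IsEmbedding : ∀ {m n} → Graph m → Graph n → (Fin m → Fin n) → Set
IsEmbedding H G φ =
  Injective _≡_ _≡_ φ ×
  (∀ u v → Edge H u v → Edge G (φ u) (φ v)) ×
  (∀ u v x y → Edge H u v → Edge H x y → ¬ Cross (φ u) (φ v) (φ x) (φ y))

Embeds : ∀ {m n} → Graph m → Graph n → Set
Embeds H G = ∃[ φ ] IsEmbedding H G φ

-- Outerplanar: admits a crossing-free straight-line drawing with vertices in
-- convex position (all vertices on the outer face), i.e. an injective
-- placement on the corners of a convex polygon with no two edges crossing.
Outerplanar : ∀ {n} → Graph n → Set
Outerplanar {n} H = ∃[ ψ ] (Injective _≡_ _≡_ ψ ×
  (∀ u v x y → Edge H u v → Edge H x y → ¬ Cross {n} (ψ u) (ψ v) (ψ x) (ψ y)))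

CycNext : ∀ {n} → Fin n → Fin n → Set
CycNext {n} i j = (toℕ j ≡ suc (toℕ i)) ⊎ (toℕ j ≡ 0 × suc (toℕ i) ≡ n)

OnCycle : ∀ {n} → (Fin n → Fin n) → Fin n → Fin n → Set
OnCycle σ u v = ∃[ i ] ∃[ j ] (CycNext i j × ((σ i ≡ u × σ j ≡ v) ⊎ (σ i ≡ v × σ j ≡ u)))

SameEdge : ∀ {n} → Fin n → Fin n → Fin n → Fin n → Set
SameEdge u v a b = (u ≡ a × v ≡ b) ⊎ (u ≡ b × v ≡ a)

CyclePlus2Chords : ∀ {n} → Graph n → Set
CyclePlus2Chords {n} H =
  Σ (Fin n → Fin n) λ σ → Injective _≡_ _≡_ σ ×
  Σ (Fin n) λ a → Σ (Fin n) λ b → Σ (Fin n) λ c → Σ (Fin n) λ d →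
    (a ≢ b × a ≢ c × a ≢ d × b ≢ c × b ≢ d × c ≢ d) ×
    ¬ OnCycle σ a b × ¬ OnCycle σ c d ×
    (∀ u v → Edge H u v ⇔ (OnCycle σ u v ⊎ SameEdge u v a b ⊎ SameEdge u v c d))
  where
    _⇔_ : Set → Set → Set
    P ⇔ Q = (P → Q) × (Q → P)

InO2 : ∀ {n} → Graph n → Set
InO2 H = Outerplanar H × CyclePlus2Chords H

UniversalO2 : ∀ {n} → Graph n → Set
UniversalO2 {n} G = (H : Graph n) → InO2 H → Embeds H G

module Submission where

-- Put the n vertices on the corners 0, …, n−1 of a convex polygon, pick k with n ≤ k² ≤ 4n, and let
-- G consist of the n hull edges and all edges at the hub set {0, …, k−1} ∪ {0, k, …, k(k−1)}; it has
-- at most 2n + 4kn = O(n^{3/2}) edges.  Draw H ∈ 𝒪₂(n) outerplanarly on the same corners.  Its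
-- Hamiltonian cycle becomes a non-crossing polygon through all corners, and such a polygon uses only
-- hull edges: a cycle edge skipping a corner would be crossed by the rest of the cycle, which has to
-- travel from one side of it to the other.  Rotating the drawing preserves crossings and hull edges,
-- and as k² ≥ n some rotation moves one endpoint of each chord into the hub set (one onto a multiple
-- of k, the other below k).  The rotated drawing is an embedding of H into G.

open import Defs hiding (sym)
open import Data.Bool using (Bool; true; false; T; not; _∧_; _∨_; if_then_else_)
open import Data.Bool.Properties using (∨-comm; T-∨; T-∧; T-≡)
open import Data.Empty using (⊥-elim)
open import Data.Fin using (Fin; toℕ; fromℕ<; punchOut)
open import Data.Fin.Properties
  using (toℕ-fromℕ<; toℕ-injective; toℕ<n; punchOut-injective; injective⇒≤; any?; ¬Fin0)
  renaming (_≟_ to _≟ᶠ_)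
open import Data.List using (List; []; _∷_; _++_; map; length; filter; allFin; cartesianProduct)
open import Data.List.Properties using (length-tabulate)
open import Data.List.Relation.Unary.All as All using (All; []; _∷_)
open import Data.List.Relation.Unary.AllPairs using ([]; _∷_)
open import Data.List.Relation.Unary.Unique.Propositional using (Unique)
open import Data.List.Relation.Unary.Unique.Propositional.Properties using (allFin⁺)
open import Data.Nat
  using (ℕ; zero; suc; pred; _+_; _*_; _^_; _∸_; _≤_; _<_; _%_; NonZero; >-nonZero⁻¹;
         z≤n; s≤s; s<s; s≤s⁻¹; s<s⁻¹; _≟_; _≤?_; _<?_; _≡ᵇ_; _<ᵇ_)
open import Data.Nat.DivMod
open import Data.Nat.Properties
open import Data.Nat.Tactic.RingSolver using (solve-∀)
open import Data.Product using (Σ; _×_; _,_; ∃; proj₁; proj₂)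
open import Data.Sum using (_⊎_; inj₁; inj₂)
open import Function.Base using (_∘_; id)
open import Function.Bundles using (_⇔_; mk⇔; Equivalence)
open import Function.Definitions using (Injective)
open import Relation.Binary.Definitions using (tri<; tri≈; tri>)
open import Relation.Binary.PropositionalEquality
open import Relation.Nullary using (¬_; Dec; yes; no; contradiction; ¬?)
open import Relation.Nullary.Decidable using (T?; _×-dec_; _⊎-dec_; decidable-stable)
open import Relation.Unary using (Decidable)

open Equivalence

count : {A : Set} → (A → Bool) → List A → ℕ
count p []       = 0
count p (x ∷ xs) = if p x then suc (count p xs) else count p xs

module _ {A : Set} where

  length-filter-T? : (p : A → Bool) (xs : List A) → length (filter (λ x → T? (p x)) xs) ≡ count p xs
  length-filter-T? p [] = refl
  length-filter-T? p (x ∷ xs) with p x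
  ... | true  = cong suc (length-filter-T? p xs)
  ... | false = length-filter-T? p xs

  count-mono : {p q : A → Bool} → (∀ x → T (p x) → T (q x)) → ∀ xs → count p xs ≤ count q xs
  count-mono p⇒q [] = z≤n
  count-mono {p} {q} p⇒q (x ∷ xs) with p x | q x | p⇒q x
  ... | true  | true  | _   = s≤s (count-mono p⇒q xs)
  ... | true  | false | imp = contradiction _ imp
  ... | false | true  | _   = m≤n⇒m≤1+n (count-mono p⇒q xs)
  ... | false | false | _   = count-mono p⇒q xs

  count-∨ : (p q : A → Bool) → ∀ xs → count (λ x → p x ∨ q x) xs ≤ count p xs + count q xs
  count-∨ p q [] = z≤n
  count-∨ p q (x ∷ xs) with p x | q x
  ... | true  | true  = s≤s (≤-trans (count-∨ p q xs) (+-monoʳ-≤ (count p xs) (n≤1+n _)))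
  ... | true  | false = s≤s (count-∨ p q xs)
  ... | false | true  = ≤-trans (s≤s (count-∨ p q xs)) (≤-reflexive (sym (+-suc _ _)))
  ... | false | false = count-∨ p q xs

  count-++ : (p : A → Bool) → ∀ xs ys → count p (xs ++ ys) ≡ count p xs + count p ys
  count-++ p [] ys = refl
  count-++ p (x ∷ xs) ys with p x
  ... | true  = cong suc (count-++ p xs ys)
  ... | false = count-++ p xs ys

  count-const : (b : Bool) (xs : List A) → count (λ _ → b) xs ≡ (if b then length xs else 0)
  count-const true  []       = refl
  count-const true  (x ∷ xs) = cong suc (count-const true xs)
  count-const false []       = refl
  count-const false (x ∷ xs) = count-const false xs

  count-none : {p : A → Bool} {xs : List A} → All (λ x → ¬ T (p x)) xs → count p xs ≡ 0
  count-none [] = refl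
  count-none {p} {x ∷ xs} (¬px ∷ rest) with p x
  ... | true  = contradiction _ ¬px
  ... | false = count-none rest

  count-≡ᵇ-injective : {g : A → ℕ} → Injective _≡_ _≡_ g → ∀ c {xs} → Unique xs →
                       count (λ y → g y ≡ᵇ c) xs ≤ 1
  count-≡ᵇ-injective inj c [] = z≤n
  count-≡ᵇ-injective {g} inj c {x ∷ xs} (x≢xs ∷ unique) with g x ≡ᵇ c in gx≡c
  ... | true  = s≤s (≤-reflexive (count-none (All.map miss x≢xs)))
    where
      miss : ∀ {y} → x ≢ y → ¬ T (g y ≡ᵇ c)
      miss x≢y gy≡c = x≢y (inj (trans (≡ᵇ⇒≡ _ _ (subst T (sym gx≡c) _)) (sym (≡ᵇ⇒≡ _ _ gy≡c))))
  ... | false = count-≡ᵇ-injective inj c unique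

count-map : {A B : Set} (p : B → Bool) (f : A → B) → ∀ xs → count p (map f xs) ≡ count (λ x → p (f x)) xs
count-map p f [] = refl
count-map p f (x ∷ xs) with p (f x)
... | true  = cong suc (count-map p f xs)
... | false = count-map p f xs

module _ {A B : Set} where

  count-cartesianProduct-rows : (p : A × B → Bool) (r : ℕ) → ∀ xs ys →
    (∀ x → count (λ y → p (x , y)) ys ≤ r) → count p (cartesianProduct xs ys) ≤ length xs * r
  count-cartesianProduct-rows p r [] ys rows = z≤n
  count-cartesianProduct-rows p r (x ∷ xs) ys rows = begin
    count p (map (x ,_) ys ++ cartesianProduct xs ys)         ≡⟨ count-++ p (map (x ,_) ys) _ ⟩
    count p (map (x ,_) ys) + count p (cartesianProduct xs ys) ≡⟨ cong (_+ _) (count-map p (x ,_) ys) ⟩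
    count (λ y → p (x , y)) ys + count p (cartesianProduct xs ys)
      ≤⟨ +-mono-≤ (rows x) (count-cartesianProduct-rows p r xs ys rows) ⟩
    r + length xs * r                                          ∎
    where open ≤-Reasoning

  count-cartesianProduct-proj₁ : (p : A → Bool) → ∀ xs ys →
    count (λ (xy : A × B) → p (proj₁ xy)) (cartesianProduct xs ys) ≡ count p xs * length ys
  count-cartesianProduct-proj₁ p [] ys = refl
  count-cartesianProduct-proj₁ p (x ∷ xs) ys = begin
    count q (map (x ,_) ys ++ cartesianProduct xs ys)          ≡⟨ count-++ q (map (x ,_) ys) _ ⟩
    count q (map (x ,_) ys) + count q (cartesianProduct xs ys) ≡⟨ cong₂ _+_ (trans (count-map q (x ,_) ys) (count-const (p x) ys))
                                                                          (count-cartesianProduct-proj₁ p xs ys) ⟩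
    (if p x then length ys else 0) + count p xs * length ys   ≡⟨ row-sum (p x) ⟩
    count p (x ∷ xs) * length ys                               ∎
    where
      open ≡-Reasoning
      q : A × B → Bool
      q xy = p (proj₁ xy)
      row-sum : (b : Bool) → (if b then length ys else 0) + count p xs * length ys
                           ≡ (if b then suc (count p xs) else count p xs) * length ys
      row-sum true  = refl
      row-sum false = refl

anyBelow : ℕ → (ℕ → Bool) → Bool
anyBelow zero    p = false
anyBelow (suc k) p = p k ∨ anyBelow k p

count-anyBelow : {A : Set} (q : ℕ → A → Bool) (xs : List A) → (∀ j → count (q j) xs ≤ 1) →
                 ∀ k → count (λ y → anyBelow k (λ j → q j y)) xs ≤ k
count-anyBelow q xs unique zero    = ≤-reflexive (count-const false xs)
count-anyBelow q xs unique (suc k) =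
  ≤-trans (count-∨ (q k) _ xs) (+-mono-≤ (unique k) (count-anyBelow q xs unique k))

[m+n%d]%d≡[m+n]%d : ∀ m n d .{{_ : NonZero d}} → (m + n % d) % d ≡ (m + n) % d
[m+n%d]%d≡[m+n]%d m n d = begin
  (m + n % d) % d          ≡⟨ %-distribˡ-+ m (n % d) d ⟩
  (m % d + n % d % d) % d  ≡⟨ cong (λ k → (m % d + k) % d) (m%n%n≡m%n n d) ⟩
  (m % d + n % d) % d      ≡⟨ %-distribˡ-+ m n d ⟨
  (m + n) % d              ∎
  where open ≡-Reasoning

[m%d+n]%d≡[m+n]%d : ∀ m n d .{{_ : NonZero d}} → (m % d + n) % d ≡ (m + n) % d
[m%d+n]%d≡[m+n]%d m n d = begin
  (m % d + n) % d  ≡⟨ cong (_% d) (+-comm (m % d) n) ⟩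
  (n + m % d) % d  ≡⟨ [m+n%d]%d≡[m+n]%d n m d ⟩
  (n + m) % d      ≡⟨ cong (_% d) (+-comm n m) ⟩
  (m + n) % d      ∎
  where open ≡-Reasoning

module _ {N : ℕ} .{{_ : NonZero N}} where

  rotate : ℕ → Fin N → Fin N
  rotate t x = fromℕ< (m%n<n (t + toℕ x) N)

  next : Fin N → Fin N
  next = rotate 1

  toℕ-rotate : ∀ t x → toℕ (rotate t x) ≡ (t + toℕ x) % N
  toℕ-rotate t x = toℕ-fromℕ< _

  rotate-rotate : ∀ s t x → rotate s (rotate t x) ≡ rotate (s + t) x
  rotate-rotate s t x = toℕ-injective (begin
    toℕ (rotate s (rotate t x))  ≡⟨ toℕ-rotate s (rotate t x) ⟩
    (s + toℕ (rotate t x)) % N   ≡⟨ cong (λ k → (s + k) % N) (toℕ-rotate t x) ⟩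
    (s + (t + toℕ x) % N) % N    ≡⟨ [m+n%d]%d≡[m+n]%d s (t + toℕ x) N ⟩
    (s + (t + toℕ x)) % N        ≡⟨ cong (_% N) (+-assoc s t (toℕ x)) ⟨
    (s + t + toℕ x) % N          ≡⟨ toℕ-rotate (s + t) x ⟨
    toℕ (rotate (s + t) x)       ∎)
    where open ≡-Reasoning

  rotate-zero : ∀ x → rotate 0 x ≡ x
  rotate-zero x = toℕ-injective (trans (toℕ-rotate 0 x) (m<n⇒m%n≡m (toℕ<n x)))

  rotate-N : ∀ x → rotate N x ≡ x
  rotate-N x = toℕ-injective (begin
    toℕ (rotate N x)  ≡⟨ toℕ-rotate N x ⟩
    (N + toℕ x) % N   ≡⟨ cong (_% N) (+-comm N (toℕ x)) ⟩
    (toℕ x + N) % N   ≡⟨ [m+n]%n≡m%n (toℕ x) N ⟩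
    toℕ x % N         ≡⟨ m<n⇒m%n≡m (toℕ<n x) ⟩
    toℕ x             ∎)
    where open ≡-Reasoning

  rotate-suc : ∀ t x → rotate (suc t) x ≡ next (rotate t x)
  rotate-suc t x = sym (rotate-rotate 1 t x)

  next-rotate : ∀ t x → next (rotate t x) ≡ rotate t (next x)
  next-rotate t x = begin
    rotate 1 (rotate t x)  ≡⟨ rotate-rotate 1 t x ⟩
    rotate (1 + t) x       ≡⟨ cong (λ s → rotate s x) (+-comm 1 t) ⟩
    rotate (t + 1) x       ≡⟨ rotate-rotate t 1 x ⟨
    rotate t (rotate 1 x)  ∎
    where open ≡-Reasoning

  rotate-pred-next : ∀ x → rotate (pred N) (next x) ≡ x
  rotate-pred-next x = begin
    rotate (pred N) (rotate 1 x)  ≡⟨ rotate-rotate (pred N) 1 x ⟩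
    rotate (pred N + 1) x         ≡⟨ cong (λ s → rotate s x) (trans (+-comm (pred N) 1) (suc-pred N)) ⟩
    rotate N x                    ≡⟨ rotate-N x ⟩
    x                             ∎
    where open ≡-Reasoning

  next-injective : Injective _≡_ _≡_ next
  next-injective {x} {y} eq = begin
    x                          ≡⟨ rotate-pred-next x ⟨
    rotate (pred N) (next x)   ≡⟨ cong (rotate (pred N)) eq ⟩
    rotate (pred N) (next y)   ≡⟨ rotate-pred-next y ⟩
    y                          ∎
    where open ≡-Reasoning

  rotate-injective : ∀ t → Injective _≡_ _≡_ (rotate t)
  rotate-injective zero {x} {y} eq =
    trans (sym (rotate-zero x)) (trans eq (rotate-zero y))
  rotate-injective (suc t) {x} {y} eq = rotate-injective t (next-injective (begin
    next (rotate t x)  ≡⟨ rotate-suc t x ⟨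
    rotate (suc t) x   ≡⟨ eq ⟩
    rotate (suc t) y   ≡⟨ rotate-suc t y ⟩
    next (rotate t y)  ∎))
    where open ≡-Reasoning

  offset : Fin N → Fin N → ℕ
  offset j v = (toℕ v + (N ∸ toℕ j)) % N

  offset<N : ∀ j v → offset j v < N
  offset<N j v = m%n<n _ N

  rotate-offset : ∀ j v → rotate (offset j v) j ≡ v
  rotate-offset j v = toℕ-injective (begin
    toℕ (rotate (offset j v) j)           ≡⟨ toℕ-rotate (offset j v) j ⟩
    ((toℕ v + (N ∸ toℕ j)) % N + toℕ j) % N ≡⟨ [m%d+n]%d≡[m+n]%d (toℕ v + (N ∸ toℕ j)) (toℕ j) N ⟩
    (toℕ v + (N ∸ toℕ j) + toℕ j) % N     ≡⟨ cong (_% N) (+-assoc (toℕ v) (N ∸ toℕ j) (toℕ j)) ⟩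
    (toℕ v + (N ∸ toℕ j + toℕ j)) % N     ≡⟨ cong (λ k → (toℕ v + k) % N) (m∸n+n≡m (<⇒≤ (toℕ<n j))) ⟩
    (toℕ v + N) % N                       ≡⟨ [m+n]%n≡m%n (toℕ v) N ⟩
    toℕ v % N                             ≡⟨ m<n⇒m%n≡m (toℕ<n v) ⟩
    toℕ v                                 ∎)
    where open ≡-Reasoning

  offset-rotate : ∀ j {s} → s < N → offset j (rotate s j) ≡ s
  offset-rotate j {s} s<N = begin
    (toℕ (rotate s j) + (N ∸ toℕ j)) % N   ≡⟨ cong (λ k → (k + (N ∸ toℕ j)) % N) (toℕ-rotate s j) ⟩
    ((s + toℕ j) % N + (N ∸ toℕ j)) % N    ≡⟨ [m%d+n]%d≡[m+n]%d (s + toℕ j) (N ∸ toℕ j) N ⟩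
    (s + toℕ j + (N ∸ toℕ j)) % N          ≡⟨ cong (_% N) (+-assoc s (toℕ j) (N ∸ toℕ j)) ⟩
    (s + (toℕ j + (N ∸ toℕ j))) % N        ≡⟨ cong (λ k → (s + k) % N) (m+[n∸m]≡n (<⇒≤ (toℕ<n j))) ⟩
    (s + N) % N                            ≡⟨ [m+n]%n≡m%n s N ⟩
    s % N                                  ≡⟨ m<n⇒m%n≡m s<N ⟩
    s                                      ∎
    where open ≡-Reasoning

  rotate-injectiveˡ : ∀ j {s t} → s < N → t < N → rotate s j ≡ rotate t j → s ≡ t
  rotate-injectiveˡ j {s} {t} s<N t<N eq =
    trans (sym (offset-rotate j s<N)) (trans (cong (offset j) eq) (offset-rotate j t<N))

  suc-toℕ≮⇒≡ : ∀ {x : Fin N} → ¬ suc (toℕ x) < N → suc (toℕ x) ≡ N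
  suc-toℕ≮⇒≡ {x} 1+x≮N = ≤-antisym (toℕ<n x) (≮⇒≥ 1+x≮N)

  toℕ-next : ∀ {x : Fin N} → suc (toℕ x) < N → toℕ (next x) ≡ suc (toℕ x)
  toℕ-next {x} 1+x<N = trans (toℕ-rotate 1 x) (m<n⇒m%n≡m 1+x<N)

  toℕ-next-last : ∀ {x : Fin N} → suc (toℕ x) ≡ N → toℕ (next x) ≡ 0
  toℕ-next-last {x} 1+x≡N = trans (toℕ-rotate 1 x) (trans (cong (_% N) 1+x≡N) (n%n≡0 N))

  cycNext-next : ∀ x → CycNext x (next x)
  cycNext-next x with suc (toℕ x) <? N
  ... | yes 1+x<N = inj₁ (toℕ-next 1+x<N)
  ... | no 1+x≮N  = inj₂ (toℕ-next-last (suc-toℕ≮⇒≡ 1+x≮N) , suc-toℕ≮⇒≡ 1+x≮N)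

  cycNext⇒≡next : ∀ {x y} → CycNext x y → y ≡ next x
  cycNext⇒≡next {x} {y} (inj₁ y≡1+x) =
    toℕ-injective (trans y≡1+x (sym (toℕ-next (subst (_< N) y≡1+x (toℕ<n y)))))
  cycNext⇒≡next (inj₂ (y≡0 , 1+x≡N)) = toℕ-injective (trans y≡0 (sym (toℕ-next-last 1+x≡N)))

Separates : ℕ → ℕ → ℕ → ℕ → Set
Separates a b c d = (Between a c b × ¬ Between a d b) ⊎ (Between a d b × ¬ Between a c b)

between? : ∀ x y z → Dec (Between x y z)
between? x y z = ((x <? y) ×-dec (y <? z)) ⊎-dec ((z <? y) ×-dec (y <? x))

between-swap : ∀ {x y z} → Between x y z → Between z y x
between-swap (inj₁ x<y<z) = inj₂ x<y<z
between-swap (inj₂ z<y<x) = inj₁ z<y<x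

between-suc : ∀ {x y z} → Between (suc x) (suc y) (suc z) ⇔ Between x y z
between-suc = mk⇔
  (λ { (inj₁ (p , q)) → inj₁ (s<s⁻¹ p , s<s⁻¹ q) ; (inj₂ (p , q)) → inj₂ (s<s⁻¹ p , s<s⁻¹ q) })
  (λ { (inj₁ (p , q)) → inj₁ (s<s p , s<s q) ; (inj₂ (p , q)) → inj₂ (s<s p , s<s q) })

¬between-zero : ∀ {x z} → ¬ Between x 0 z
¬between-zero (inj₁ (() , _))
¬between-zero (inj₂ (() , _))

¬between-max : ∀ {x y z} → x < y → z < y → ¬ Between x y z
¬between-max x<y z<y (inj₁ (_ , y<z)) = <-asym y<z z<y
¬between-max x<y z<y (inj₂ (_ , y<x)) = <-asym y<x x<y

¬between-left : ∀ {x z} → ¬ Between x x z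
¬between-left (inj₁ (x<x , _)) = <-irrefl refl x<x
¬between-left (inj₂ (_ , x<x)) = <-irrefl refl x<x

¬between-right : ∀ {x z} → ¬ Between x z z
¬between-right (inj₁ (_ , z<z)) = <-irrefl refl z<z
¬between-right (inj₂ (z<z , _)) = <-irrefl refl z<z

¬between-same : ∀ {x y} → ¬ Between x y x
¬between-same (inj₁ (x<y , y<x)) = <-asym x<y y<x
¬between-same (inj₂ (x<y , y<x)) = <-asym x<y y<x

¬separates-same : ∀ {x c d} → ¬ Separates x x c d
¬separates-same (inj₁ (c∈ , _)) = ¬between-same c∈
¬separates-same (inj₂ (d∈ , _)) = ¬between-same d∈

separates-swap : ∀ {a b c d} → Separates a b c d → Separates b a c d
separates-swap (inj₁ (c∈ , d∉)) = inj₁ (between-swap c∈ , λ d∈ → d∉ (between-swap d∈))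
separates-swap (inj₂ (d∈ , c∉)) = inj₂ (between-swap d∈ , λ c∈ → c∉ (between-swap c∈))

separates-transport : ∀ {a b c d a′ b′ c′ d′} →
  Between a′ c′ b′ ⇔ Between a c b → Between a′ d′ b′ ⇔ Between a d b →
  Separates a′ b′ c′ d′ → Separates a b c d
separates-transport c↔ d↔ (inj₁ (c∈ , d∉)) = inj₁ (to c↔ c∈ , λ d∈ → d∉ (from d↔ d∈))
separates-transport c↔ d↔ (inj₂ (d∈ , c∉)) = inj₂ (to d↔ d∈ , λ c∈ → c∉ (from c↔ c∈))

separates-transport-¬ : ∀ {a b c d a′ b′ c′ d′} →
  Between a′ c′ b′ ⇔ (¬ Between a c b) → Between a′ d′ b′ ⇔ (¬ Between a d b) →
  Separates a′ b′ c′ d′ → Separates a b c d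
separates-transport-¬ {a} {b} {c} {d} c↔ d↔ (inj₁ (c∈ , d∉)) =
  inj₂ (decidable-stable (between? a d b) (λ d∉′ → d∉ (from d↔ d∉′)) , to c↔ c∈)
separates-transport-¬ {a} {b} {c} {d} c↔ d↔ (inj₂ (d∈ , c∉)) =
  inj₁ (decidable-stable (between? a c b) (λ c∉′ → c∉ (from c↔ c∉′)) , to d↔ d∈)

module _ {N : ℕ} .{{_ : NonZero N}} where

  between-next : ∀ {a b : Fin N} x → suc (toℕ a) < N → suc (toℕ b) < N →
    Between (toℕ (next a)) (toℕ (next x)) (toℕ (next b)) ⇔ Between (toℕ a) (toℕ x) (toℕ b)
  between-next {a} {b} x 1+a<N 1+b<N rewrite toℕ-next 1+a<N | toℕ-next 1+b<N with suc (toℕ x) <? N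
  ... | yes 1+x<N rewrite toℕ-next 1+x<N = between-suc
  ... | no 1+x≮N = mk⇔
    (λ x′∈ → ⊥-elim (¬between-zero (subst (λ k → Between _ k _) (toℕ-next-last 1+x≡N) x′∈)))
    (λ x∈ → ⊥-elim (¬between-max a<x b<x x∈))
    where
      1+x≡N : suc (toℕ x) ≡ N
      1+x≡N = suc-toℕ≮⇒≡ 1+x≮N
      a<x : toℕ a < toℕ x
      a<x = s<s⁻¹ (subst (suc (toℕ a) <_) (sym 1+x≡N) 1+a<N)
      b<x : toℕ b < toℕ x
      b<x = s<s⁻¹ (subst (suc (toℕ b) <_) (sym 1+x≡N) 1+b<N)

  suc-toℕ<N : ∀ {a x : Fin N} → suc (toℕ a) ≡ N → x ≢ a → suc (toℕ x) < N
  suc-toℕ<N {a} {x} 1+a≡N x≢a =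
    ≤∧≢⇒< (toℕ<n x) (λ 1+x≡N → x≢a (toℕ-injective (suc-injective (trans 1+x≡N (sym 1+a≡N)))))

  -- When a is the last corner, next a is 0 and the arc between a and b turns into its complement.
  between-next-wrap : ∀ {a b : Fin N} x → suc (toℕ a) ≡ N → suc (toℕ b) < N → x ≢ a → x ≢ b →
    Between (toℕ (next a)) (toℕ (next x)) (toℕ (next b)) ⇔ (¬ Between (toℕ a) (toℕ x) (toℕ b))
  between-next-wrap {a} {b} x 1+a≡N 1+b<N x≢a x≢b
    rewrite toℕ-next-last 1+a≡N | toℕ-next 1+b<N | toℕ-next (suc-toℕ<N 1+a≡N x≢a) = mk⇔
      (λ { (inj₁ (_ , 1+x<1+b)) → x<b⇒∉ (s<s⁻¹ 1+x<1+b) ; (inj₂ (_ , ())) })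
      (λ x∉ → inj₁ (s≤s z≤n , s<s (∉⇒x<b x∉)))
    where
      x<a : toℕ x < toℕ a
      x<a = s<s⁻¹ (subst (suc (toℕ x) <_) (sym 1+a≡N) (suc-toℕ<N 1+a≡N x≢a))
      x<b⇒∉ : toℕ x < toℕ b → ¬ Between (toℕ a) (toℕ x) (toℕ b)
      x<b⇒∉ x<b (inj₁ (a<x , _)) = <-asym a<x x<a
      x<b⇒∉ x<b (inj₂ (b<x , _)) = <-asym x<b b<x
      ∉⇒x<b : ¬ Between (toℕ a) (toℕ x) (toℕ b) → toℕ x < toℕ b
      ∉⇒x<b x∉ = ≤∧≢⇒< (≮⇒≥ (λ b<x → x∉ (inj₂ (b<x , x<a)))) (λ x≡b → x≢b (toℕ-injective x≡b))

  cross-next⁻ : ∀ {a b c d : Fin N} → Cross (next a) (next b) (next c) (next d) → Cross a b c d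
  cross-next⁻ {a} {b} {c} {d} (a≢c , a≢d , b≢c , b≢d , sep) =
    a≢c ∘ cong next , a≢d ∘ cong next , b≢c ∘ cong next , b≢d ∘ cong next ,
    separates (suc (toℕ a) <? N) (suc (toℕ b) <? N)
    where
      separates : Dec (suc (toℕ a) < N) → Dec (suc (toℕ b) < N) → Separates (toℕ a) (toℕ b) (toℕ c) (toℕ d)
      separates (yes 1+a<N) (yes 1+b<N) =
        separates-transport (between-next c 1+a<N 1+b<N) (between-next d 1+a<N 1+b<N) sep
      separates (no 1+a≮N) (yes 1+b<N) =
        separates-transport-¬
          (between-next-wrap c (suc-toℕ≮⇒≡ 1+a≮N) 1+b<N (a≢c ∘ cong next ∘ sym) (b≢c ∘ cong next ∘ sym))
          (between-next-wrap d (suc-toℕ≮⇒≡ 1+a≮N) 1+b<N (a≢d ∘ cong next ∘ sym) (b≢d ∘ cong next ∘ sym)) sep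
      separates (yes 1+a<N) (no 1+b≮N) = separates-swap (
        separates-transport-¬
          (between-next-wrap c (suc-toℕ≮⇒≡ 1+b≮N) 1+a<N (b≢c ∘ cong next ∘ sym) (a≢c ∘ cong next ∘ sym))
          (between-next-wrap d (suc-toℕ≮⇒≡ 1+b≮N) 1+a<N (b≢d ∘ cong next ∘ sym) (a≢d ∘ cong next ∘ sym))
          (separates-swap sep))
      separates (no 1+a≮N) (no 1+b≮N) = ⊥-elim (¬separates-same (subst₂ (λ u v → Separates u v _ _)
        (toℕ-next-last (suc-toℕ≮⇒≡ 1+a≮N)) (toℕ-next-last (suc-toℕ≮⇒≡ 1+b≮N)) sep))

  cross-rotate⁻ : ∀ t {a b c d : Fin N} →
    Cross (rotate t a) (rotate t b) (rotate t c) (rotate t d) → Cross a b c d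
  cross-rotate⁻ zero {a} {b} {c} {d} rewrite rotate-zero a | rotate-zero b | rotate-zero c | rotate-zero d = id
  cross-rotate⁻ (suc t) {a} {b} {c} {d} rewrite rotate-suc t a | rotate-suc t b | rotate-suc t c | rotate-suc t d =
    cross-rotate⁻ t ∘ cross-next⁻

injective⇒surjective : ∀ {n} {f : Fin n → Fin n} → Injective _≡_ _≡_ f → ∀ y → ∃ λ x → f x ≡ y
injective⇒surjective {zero} f-inj ()
injective⇒surjective {suc n} {f} f-inj y with any? (λ x → f x ≟ᶠ y)
... | yes hit = hit
... | no miss = contradiction (injective⇒≤ g-inj) (<-irrefl refl)
  where
    y≢f : ∀ x → y ≢ f x
    y≢f x y≡fx = miss (x , sym y≡fx)
    g : Fin (suc n) → Fin n
    g x = punchOut (y≢f x)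
    g-inj : Injective _≡_ _≡_ g
    g-inj {a} {b} ga≡gb = f-inj (punchOut-injective (y≢f a) (y≢f b) ga≡gb)

switch-up : ∀ {P : ℕ → Set} → Decidable P → ∀ {x y} → x ≤ y → P x → ¬ P y →
            ∃ λ s → x ≤ s × s < y × P s × ¬ P (suc s)
switch-up P? {y = zero} z≤n px ¬py = contradiction px ¬py
switch-up P? {x} {suc y} x≤1+y px ¬p1+y with x ≟ suc y | P? y
... | yes refl | _       = contradiction px ¬p1+y
... | no x≢1+y | yes py  = y , x≤y , n<1+n y , py , ¬p1+y
  where
    x≤y : x ≤ y
    x≤y = s≤s⁻¹ (≤∧≢⇒< x≤1+y x≢1+y)
... | no x≢1+y | no ¬py with switch-up P? (s≤s⁻¹ (≤∧≢⇒< x≤1+y x≢1+y)) px ¬py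
...   | s , x≤s , s<y , ps , ¬p1+s = s , x≤s , m<n⇒m<1+n s<y , ps , ¬p1+s

switch : ∀ {P : ℕ → Set} → Decidable P → ∀ {lo hi x y} → lo ≤ x → x < hi → lo ≤ y → y < hi →
         P x → ¬ P y → ∃ λ s → lo ≤ s × suc s < hi × ((P s × ¬ P (suc s)) ⊎ (P (suc s) × ¬ P s))
switch P? {x = x} {y} lo≤x x<hi lo≤y y<hi px ¬py with ≤-<-connex x y
... | inj₁ x≤y with switch-up P? x≤y px ¬py
...   | s , x≤s , s<y , ps , ¬p1+s = s , ≤-trans lo≤x x≤s , <-≤-trans (s≤s s<y) y<hi , inj₁ (ps , ¬p1+s)
switch P? {x = x} {y} lo≤x x<hi lo≤y y<hi px ¬py | inj₂ y<x
  with switch-up (¬? ∘ P?) (<⇒≤ y<x) ¬py (λ ¬px → ¬px px)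
...   | s , y≤s , s<x , ¬ps , ¬¬p1+s =
  s , ≤-trans lo≤y y≤s , <-≤-trans (s≤s s<x) x<hi , inj₂ (decidable-stable (P? (suc s)) ¬¬p1+s , ¬ps)

module _ {N : ℕ} .{{_ : NonZero N}} where

  HullEdge : Fin N → Fin N → Set
  HullEdge x y = CycNext x y ⊎ CycNext y x

  hullEdge-sym : ∀ {x y : Fin N} → HullEdge x y → HullEdge y x
  hullEdge-sym (inj₁ xy) = inj₂ xy
  hullEdge-sym (inj₂ yx) = inj₁ yx

  cycNext? : (x y : Fin N) → Dec (CycNext x y)
  cycNext? x y = (toℕ y ≟ suc (toℕ x)) ⊎-dec ((toℕ y ≟ 0) ×-dec (suc (toℕ x) ≟ N))

  hullEdge? : (x y : Fin N) → Dec (HullEdge x y)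
  hullEdge? x y = cycNext? x y ⊎-dec cycNext? y x

  Straddled : Fin N → Fin N → Set
  Straddled x y = (∃ λ (z : Fin N) → Between (toℕ x) (toℕ z) (toℕ y)) ×
                  (∃ λ (w : Fin N) → w ≢ x × w ≢ y × ¬ Between (toℕ x) (toℕ w) (toℕ y))

  straddled-sym : ∀ {x y : Fin N} → Straddled x y → Straddled y x
  straddled-sym ((z , z∈) , (w , w≢x , w≢y , w∉)) =
    (z , between-swap z∈) , (w , w≢y , w≢x , w∉ ∘ between-swap)

  non-hull-edge-straddled< : ∀ {x y : Fin N} → toℕ x < toℕ y → ¬ HullEdge x y → Straddled x y
  non-hull-edge-straddled< {x} {y} x<y ¬hull = (next x , next-x-inside) , (next y , next-y-outside (suc (toℕ y) <? N))
    where
      1+x≢y : suc (toℕ x) ≢ toℕ y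
      1+x≢y 1+x≡y = ¬hull (inj₁ (inj₁ (sym 1+x≡y)))
      next-x-inside : Between (toℕ x) (toℕ (next x)) (toℕ y)
      next-x-inside rewrite toℕ-next {x = x} (<-≤-trans (s≤s x<y) (toℕ<n y)) = inj₁ (n<1+n _ , ≤∧≢⇒< x<y 1+x≢y)
      next-y-outside : Dec (suc (toℕ y) < N) → next y ≢ x × next y ≢ y × ¬ Between (toℕ x) (toℕ (next y)) (toℕ y)
      next-y-outside (yes 1+y<N) =
        (λ e → <⇒≢ (<-trans x<y y<next) (cong toℕ (sym e))) ,
        (λ e → <⇒≢ y<next (cong toℕ (sym e))) ,
        ¬between-max (<-trans x<y y<next) y<next
        where
          y<next : toℕ y < toℕ (next y)
          y<next = subst (toℕ y <_) (sym (toℕ-next 1+y<N)) (n<1+n _)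
      next-y-outside (no 1+y≮N) =
        (λ e → ¬hull (inj₂ (inj₂ (trans (cong toℕ (sym e)) next≡0 , 1+y≡N)))) ,
        (λ e → <⇒≢ (≤-<-trans z≤n x<y) (sym (trans (cong toℕ (sym e)) next≡0))) ,
        (λ w∈ → ¬between-zero (subst (λ k → Between (toℕ x) k (toℕ y)) next≡0 w∈))
        where
          1+y≡N : suc (toℕ y) ≡ N
          1+y≡N = suc-toℕ≮⇒≡ 1+y≮N
          next≡0 : toℕ (next y) ≡ 0
          next≡0 = toℕ-next-last 1+y≡N

  non-hull-edge-straddled : ∀ {x y : Fin N} → x ≢ y → ¬ HullEdge x y → Straddled x y
  non-hull-edge-straddled {x} {y} x≢y ¬hull with <-cmp (toℕ x) (toℕ y)
  ... | tri< x<y _ _ = non-hull-edge-straddled< x<y ¬hull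
  ... | tri≈ _ x≡y _ = contradiction (toℕ-injective x≡y) x≢y
  ... | tri> _ _ y<x = straddled-sym (non-hull-edge-straddled< y<x (¬hull ∘ hullEdge-sym))

  pred-N<N : pred N < N
  pred-N<N = subst (pred N <_) (suc-pred N) (n<1+n (pred N))

  cycNext⇒≡rotate-pred : ∀ {i j : Fin N} → CycNext i j → i ≡ rotate (pred N) j
  cycNext⇒≡rotate-pred {i} i→j = trans (sym (rotate-pred-next i)) (cong (rotate (pred N)) (sym (cycNext⇒≡next i→j)))

  module _ {π : Fin N → Fin N} (π-injective : Injective _≡_ _≡_ π) {i j : Fin N} (i→j : CycNext i j) where

    private
      i≡last : i ≡ rotate (pred N) j
      i≡last = cycNext⇒≡rotate-pred i→j

      inside? : Decidable (λ t → Between (toℕ (π i)) (toℕ (π (rotate t j))) (toℕ (π j)))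
      inside? t = between? _ _ _

    walk-distinct : ∀ {s t} → s < N → t < N → s ≢ t → π (rotate s j) ≢ π (rotate t j)
    walk-distinct s<N t<N s≢t = s≢t ∘ rotate-injectiveˡ j s<N t<N ∘ π-injective

    walk-index : ∀ z → z ≢ π i → z ≢ π j → ∃ λ s → 1 ≤ s × s < pred N × π (rotate s j) ≡ z
    walk-index z z≢πi z≢πj with injective⇒surjective π-injective z
    ... | v , πv≡z = offset j v , n≢0⇒n>0 s≢0 , ≤∧≢⇒< (m<1+n⇒m≤n s<1+last) s≢last , πwalk≡z
      where
        s : ℕ
        s = offset j v
        πwalk≡z : π (rotate s j) ≡ z
        πwalk≡z = trans (cong π (rotate-offset j v)) πv≡z
        s≢0 : s ≢ 0
        s≢0 s≡0 = z≢πj (trans (sym πwalk≡z) (cong π (trans (cong (λ t → rotate t j) s≡0) (rotate-zero j))))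
        s≢last : s ≢ pred N
        s≢last s≡last = z≢πi (trans (sym πwalk≡z) (cong π (trans (cong (λ t → rotate t j) s≡last) (sym i≡last))))
        s<1+last : s < suc (pred N)
        s<1+last = subst (s <_) (sym (suc-pred N)) (offset<N j v)

    -- If π i π j is not a hull edge, the walk j, next j, …, back to i passes a corner inside and a
    -- corner outside the chord, so one of its steps crosses it.
    polygon-edge-is-hull : (∀ i j i′ j′ → CycNext i j → CycNext i′ j′ → ¬ Cross (π i) (π j) (π i′) (π j′)) →
                           π i ≢ π j → HullEdge (π i) (π j)
    polygon-edge-is-hull noncrossing πi≢πj with hullEdge? (π i) (π j)
    ... | yes hull = hull
    ... | no ¬hull with non-hull-edge-straddled πi≢πj ¬hull
    ... | (z , z∈) , (w , w≢πi , w≢πj , w∉)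
      with walk-index z (λ z≡πi → ¬between-left (subst (λ k → Between _ k _) (cong toℕ z≡πi) z∈))
                        (λ z≡πj → ¬between-right (subst (λ k → Between _ k _) (cong toℕ z≡πj) z∈))
         | walk-index w w≢πi w≢πj
    ... | s₁ , 1≤s₁ , s₁<last , walk-s₁≡z | s₂ , 1≤s₂ , s₂<last , walk-s₂≡w
      with switch inside? 1≤s₁ s₁<last 1≤s₂ s₂<last
             (subst (λ k → Between _ (toℕ k) _) (sym walk-s₁≡z) z∈)
             (λ p → w∉ (subst (λ k → Between _ (toℕ k) _) walk-s₂≡w p))
    ... | s , 1≤s , 1+s<last , separates =
      contradiction (ne-last s<last , ne-last 1+s<last , ne-first 1≤s s<last , ne-first (s≤s z≤n) 1+s<last , separates)
                    (noncrossing i j (rotate s j) (rotate (suc s) j) i→j step)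
      where
        s<last : s < pred N
        s<last = <-trans (n<1+n s) 1+s<last
        ne-last : ∀ {t} → t < pred N → π i ≢ π (rotate t j)
        ne-last {t} t<last = subst (λ k → π k ≢ π (rotate t j)) (sym i≡last)
          (walk-distinct pred-N<N (<-trans t<last pred-N<N) (>⇒≢ t<last))
        ne-first : ∀ {t} → 1 ≤ t → t < pred N → π j ≢ π (rotate t j)
        ne-first {t} 1≤t t<last = subst (λ k → π k ≢ π (rotate t j)) (rotate-zero j)
          (walk-distinct (≤-<-trans z≤n pred-N<N) (<-trans t<last pred-N<N) (<⇒≢ 1≤t))
        step : CycNext (rotate s j) (rotate (suc s) j)
        step = subst (CycNext (rotate s j)) (sym (rotate-suc s j)) (cycNext-next (rotate s j))

suc-square≤ : ∀ k → suc k * suc k ≤ 4 * suc (k * k)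
suc-square≤ k = begin
  suc k * suc k                      ≡⟨ expand k ⟩
  k * k + 2 * k + 1                  ≤⟨ +-monoˡ-≤ 1 (+-monoʳ-≤ (k * k) 2k≤3k²+3) ⟩
  k * k + (3 * (k * k) + 3) + 1      ≡⟨ collect k ⟩
  4 * suc (k * k)                    ∎
  where
    open ≤-Reasoning
    expand : ∀ k → suc k * suc k ≡ k * k + 2 * k + 1
    expand = solve-∀
    collect : ∀ k → k * k + (3 * (k * k) + 3) + 1 ≡ 4 * suc (k * k)
    collect = solve-∀
    k≤k²+1 : ∀ k → k ≤ k * k + 1
    k≤k²+1 zero    = z≤n
    k≤k²+1 (suc k) = ≤-trans (m≤m*n (suc k) (suc k)) (m≤m+n _ 1)
    2k≤3k²+3 : 2 * k ≤ 3 * (k * k) + 3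
    2k≤3k²+3 = begin
      2 * k                ≤⟨ *-monoʳ-≤ 2 (k≤k²+1 k) ⟩
      2 * (k * k + 1)      ≡⟨ *-distribˡ-+ 2 (k * k) 1 ⟩
      2 * (k * k) + 2      ≤⟨ +-mono-≤ (*-monoˡ-≤ (k * k) (n≤1+n 2)) (n≤1+n 2) ⟩
      3 * (k * k) + 3      ∎

square-bracket : ∀ n → ∃ λ k → n ≤ k * k × k * k ≤ 4 * n
square-bracket zero = 0 , z≤n , z≤n
square-bracket (suc n) with square-bracket n
... | k , n≤k² , k²≤4n with suc n ≤? k * k
...   | yes 1+n≤k² = k , 1+n≤k² , ≤-trans k²≤4n (*-monoʳ-≤ 4 (n≤1+n n))
...   | no 1+n≰k² = suc k , 1+n≤[1+k]² , ≤-trans (suc-square≤ k) (*-monoʳ-≤ 4 (s≤s k²≤n))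
  where
    k²≤n : k * k ≤ n
    k²≤n = s≤s⁻¹ (≰⇒> 1+n≰k²)
    1+n≤[1+k]² : suc n ≤ suc k * suc k
    1+n≤[1+k]² = ≤-trans (s≤s (≤-reflexive (≤-antisym n≤k² k²≤n))) (*-mono-< (n<1+n k) (n<1+n k))

multiple-in-window : ∀ {k} → 1 ≤ k → ∀ M → ∃ λ j → M ≤ k * j × k * j < M + k
multiple-in-window {k} 1≤k zero = 0 , z≤n , subst (_< k) (sym (*-zeroʳ k)) 1≤k
multiple-in-window {k} 1≤k (suc M) with multiple-in-window 1≤k M
... | j , M≤kj , kj<M+k with suc M ≤? k * j
...   | yes 1+M≤kj = j , 1+M≤kj , m<n⇒m<1+n kj<M+k
...   | no 1+M≰kj = suc j , subst (suc M ≤_) (sym k[1+j]≡M+k) (subst (_≤ M + k) (+-comm M 1) (+-monoʳ-≤ M 1≤k)) ,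
                    subst (_< suc M + k) (sym k[1+j]≡M+k) (n<1+n (M + k))
  where
    k[1+j]≡M+k : k * suc j ≡ M + k
    k[1+j]≡M+k = begin
      k * suc j  ≡⟨ *-suc k j ⟩
      k + k * j  ≡⟨ cong (k +_) (≤-antisym (s≤s⁻¹ (≰⇒> 1+M≰kj)) M≤kj) ⟩
      k + M      ≡⟨ +-comm k M ⟩
      M + k      ∎
      where open ≡-Reasoning

≤-square⇒positive : ∀ {N k} .{{_ : NonZero N}} → N ≤ k * k → 1 ≤ k
≤-square⇒positive {N} {zero}  N≤0 = contradiction N≤0 (<⇒≱ (>-nonZero⁻¹ N))
≤-square⇒positive {N} {suc k} _   = s≤s z≤n

-- Unless δ < k already, take a multiple k·j in the window [N − δ, N − δ + k); then δ + k·j wraps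
-- around to a value below k, and k·j < N because δ ≥ k.
hub-offset : ∀ {N k δ} .{{_ : NonZero N}} → N ≤ k * k → δ < N →
             ∃ λ j → j < k × k * j < N × (δ + k * j) % N < k
hub-offset {N} {k} {δ} N≤k² δ<N with δ <? k
... | yes δ<k = 0 , ≤-<-trans z≤n δ<k , subst (_< N) (sym (*-zeroʳ k)) (≤-<-trans z≤n δ<N) , δ+k0%N<k
  where
    δ+k0%N<k : (δ + k * 0) % N < k
    δ+k0%N<k rewrite *-zeroʳ k | +-identityʳ δ | m<n⇒m%n≡m δ<N = δ<k
... | no δ≮k with multiple-in-window (≤-square⇒positive N≤k²) (N ∸ δ)
...   | j , N-δ≤kj , kj<N-δ+k = j , *-cancelˡ-< k j k (<-≤-trans kj<N N≤k²) , kj<N , wrapped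
  where
    open ≤-Reasoning
    k≤δ : k ≤ δ
    k≤δ = ≮⇒≥ δ≮k
    N-δ+δ≡N : N ∸ δ + δ ≡ N
    N-δ+δ≡N = m∸n+n≡m (<⇒≤ δ<N)
    kj<N : k * j < N
    kj<N = begin-strict
      k * j        <⟨ kj<N-δ+k ⟩
      N ∸ δ + k    ≤⟨ +-monoʳ-≤ (N ∸ δ) k≤δ ⟩
      N ∸ δ + δ    ≡⟨ N-δ+δ≡N ⟩
      N            ∎
    N≤δ+kj : N ≤ δ + k * j
    N≤δ+kj = begin
      N            ≡⟨ N-δ+δ≡N ⟨
      N ∸ δ + δ    ≤⟨ +-monoˡ-≤ δ N-δ≤kj ⟩
      k * j + δ    ≡⟨ +-comm (k * j) δ ⟩
      δ + k * j    ∎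
    r : ℕ
    r = δ + k * j ∸ N
    r+N≡δ+kj : r + N ≡ δ + k * j
    r+N≡δ+kj = m∸n+n≡m N≤δ+kj
    r<k : r < k
    r<k = +-cancelʳ-< N r k (begin-strict
      r + N          ≡⟨ r+N≡δ+kj ⟩
      δ + k * j      <⟨ +-monoʳ-< δ kj<N-δ+k ⟩
      δ + (N ∸ δ + k) ≡⟨ +-comm δ (N ∸ δ + k) ⟩
      N ∸ δ + k + δ  ≡⟨ +-assoc (N ∸ δ) k δ ⟩
      N ∸ δ + (k + δ) ≡⟨ cong (N ∸ δ +_) (+-comm k δ) ⟩
      N ∸ δ + (δ + k) ≡⟨ +-assoc (N ∸ δ) δ k ⟨
      N ∸ δ + δ + k  ≡⟨ cong (_+ k) N-δ+δ≡N ⟩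
      N + k          ≡⟨ +-comm N k ⟩
      k + N          ∎)
    wrapped : (δ + k * j) % N < k
    wrapped = begin-strict
      (δ + k * j) % N  ≡⟨ cong (_% N) r+N≡δ+kj ⟨
      (r + N) % N      ≡⟨ [m+n]%n≡m%n r N ⟩
      r % N            ≡⟨ m<n⇒m%n≡m (<-≤-trans r<k (≤-trans k≤δ (<⇒≤ δ<N))) ⟩
      r                <⟨ r<k ⟩
      k                ∎

square≤144·cube : ∀ {N k E} → 1 ≤ k → k * k ≤ 4 * N → E ≤ N * 2 + ((k + k) * N + N * (k + k)) →
                  E ^ 2 ≤ 144 * N ^ 3
square≤144·cube {N} {k} {E} 1≤k k²≤4N E≤ = begin
  E ^ 2                     ≤⟨ ^-monoˡ-≤ 2 E≤6kN ⟩
  (6 * (k * N)) ^ 2         ≡⟨ cong (6 * (k * N) *_) (*-identityʳ (6 * (k * N))) ⟩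
  6 * (k * N) * (6 * (k * N)) ≡⟨ square-out k N ⟩
  36 * (k * k) * (N * N)    ≤⟨ *-monoˡ-≤ (N * N) (*-monoʳ-≤ 36 k²≤4N) ⟩
  36 * (4 * N) * (N * N)    ≡⟨ cube N ⟩
  144 * (N * (N * N))       ≡⟨ cong (λ x → 144 * (N * (N * x))) (*-identityʳ N) ⟨
  144 * N ^ 3               ∎
  where
    open ≤-Reasoning
    square-out : ∀ k N → 6 * (k * N) * (6 * (k * N)) ≡ 36 * (k * k) * (N * N)
    square-out = solve-∀
    cube : ∀ N → 36 * (4 * N) * (N * N) ≡ 144 * (N * (N * N))
    cube = solve-∀
    regroup : ∀ k N → N * 2 + ((k + k) * N + N * (k + k)) ≡ 2 * N + 4 * (k * N)
    regroup = solve-∀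
    N≤kN : N ≤ k * N
    N≤kN = subst (_≤ k * N) (*-identityˡ N) (*-monoˡ-≤ N 1≤k)
    E≤6kN : E ≤ 6 * (k * N)
    E≤6kN = begin
      E                                      ≤⟨ E≤ ⟩
      N * 2 + ((k + k) * N + N * (k + k))    ≡⟨ regroup k N ⟩
      2 * N + 4 * (k * N)                    ≤⟨ +-monoˡ-≤ (4 * (k * N)) (*-monoʳ-≤ 2 N≤kN) ⟩
      2 * (k * N) + 4 * (k * N)              ≡⟨ *-distribʳ-+ (k * N) 2 4 ⟨
      6 * (k * N)                            ∎

T-∨-introˡ : ∀ {a} b → T a → T (a ∨ b)
T-∨-introˡ b ta = from (T-∨ {y = b}) (inj₁ ta)

T-∨-introʳ : ∀ a {b} → T b → T (a ∨ b)
T-∨-introʳ a tb = from (T-∨ {x = a}) (inj₂ tb)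

anyBelow-intro : ∀ (p : ℕ → Bool) {j k} → j < k → T (p j) → T (anyBelow k p)
anyBelow-intro p {j} {suc k} j<1+k pj with m<1+n⇒m<n∨m≡n j<1+k
... | inj₁ j<k  = T-∨-introʳ (p k) (anyBelow-intro p j<k pj)
... | inj₂ refl = T-∨-introˡ (anyBelow k p) pj

≡ᵇ-comm : ∀ m n → (m ≡ᵇ n) ≡ (n ≡ᵇ m)
≡ᵇ-comm zero    zero    = refl
≡ᵇ-comm zero    (suc n) = refl
≡ᵇ-comm (suc m) zero    = refl
≡ᵇ-comm (suc m) (suc n) = ≡ᵇ-comm m n

T-not-≡ᵇ : ∀ {m n} → m ≢ n → T (not (m ≡ᵇ n))
T-not-≡ᵇ {m} {n} m≢n with m ≡ᵇ n in m≡ᵇn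
... | true  = contradiction (≡ᵇ⇒≡ m n (subst T (sym m≡ᵇn) _)) m≢n
... | false = _

isHub : ℕ → ℕ → Bool
isHub k x = anyBelow k (λ j → x ≡ᵇ j) ∨ anyBelow k (λ j → x ≡ᵇ k * j)

module _ {N : ℕ} .{{_ : NonZero N}} where

  hullAdj : Fin N → Fin N → Bool
  hullAdj x y = (toℕ y ≡ᵇ toℕ (next x)) ∨ (toℕ (next y) ≡ᵇ toℕ x)

  hubAdj : ℕ → Fin N → Fin N → Bool
  hubAdj k x y = not (toℕ x ≡ᵇ toℕ y) ∧ (hullAdj x y ∨ (isHub k (toℕ x) ∨ isHub k (toℕ y)))

  hubGraph : ℕ → Graph N
  hubGraph k = record
    { adj    = hubAdj k
    ; sym    = λ x y → cong₂ _∧_ (cong not (≡ᵇ-comm (toℕ x) (toℕ y)))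
                                 (cong₂ _∨_ (hullAdj-comm x y) (∨-comm (isHub k (toℕ x)) _))
    ; irrefl = hubAdj-irrefl
    }
    where
      hubAdj-irrefl : ∀ x → hubAdj k x x ≡ false
      hubAdj-irrefl x rewrite to T-≡ (≡⇒≡ᵇ (toℕ x) (toℕ x) refl) = refl
      hullAdj-comm : ∀ x y → hullAdj x y ≡ hullAdj y x
      hullAdj-comm x y = begin
        (toℕ y ≡ᵇ toℕ (next x)) ∨ (toℕ (next y) ≡ᵇ toℕ x)  ≡⟨ cong₂ _∨_ (≡ᵇ-comm (toℕ y) _) (≡ᵇ-comm _ (toℕ x)) ⟩
        (toℕ (next x) ≡ᵇ toℕ y) ∨ (toℕ x ≡ᵇ toℕ (next y))  ≡⟨ ∨-comm (toℕ (next x) ≡ᵇ toℕ y) _ ⟩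
        (toℕ x ≡ᵇ toℕ (next y)) ∨ (toℕ (next x) ≡ᵇ toℕ y)  ∎
        where open ≡-Reasoning

  hullEdge⇒hullAdj : ∀ {x y} → HullEdge x y → T (hullAdj x y)
  hullEdge⇒hullAdj (inj₁ x→y) = T-∨-introˡ _ (≡⇒≡ᵇ _ _ (cong toℕ (cycNext⇒≡next x→y)))
  hullEdge⇒hullAdj (inj₂ y→x) = T-∨-introʳ _ (≡⇒≡ᵇ _ _ (cong toℕ (sym (cycNext⇒≡next y→x))))

  hubGraph-edge : ∀ k {x y} → x ≢ y → HullEdge x y ⊎ T (isHub k (toℕ x)) ⊎ T (isHub k (toℕ y)) →
                  Edge (hubGraph k) x y
  hubGraph-edge k {x} {y} x≢y reason = to T-≡ (from T-∧ (T-not-≡ᵇ (x≢y ∘ toℕ-injective) , adjacent reason))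
    where
      adjacent : HullEdge x y ⊎ T (isHub k (toℕ x)) ⊎ T (isHub k (toℕ y)) →
                 T (hullAdj x y ∨ (isHub k (toℕ x) ∨ isHub k (toℕ y)))
      adjacent (inj₁ hull)        = T-∨-introˡ _ (hullEdge⇒hullAdj hull)
      adjacent (inj₂ (inj₁ hubx)) = T-∨-introʳ (hullAdj x y) (T-∨-introˡ _ hubx)
      adjacent (inj₂ (inj₂ huby)) = T-∨-introʳ (hullAdj x y) (T-∨-introʳ (isHub k (toℕ x)) huby)

  cycNext-rotate : ∀ t {x y : Fin N} → CycNext x y → CycNext (rotate t x) (rotate t y)
  cycNext-rotate t {x} {y} x→y = subst (CycNext (rotate t x))
    (trans (next-rotate t x) (cong (rotate t) (sym (cycNext⇒≡next x→y)))) (cycNext-next (rotate t x))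

  hullEdge-rotate : ∀ t {x y : Fin N} → HullEdge x y → HullEdge (rotate t x) (rotate t y)
  hullEdge-rotate t (inj₁ x→y) = inj₁ (cycNext-rotate t x→y)
  hullEdge-rotate t (inj₂ y→x) = inj₂ (cycNext-rotate t y→x)

  -- Rotating p onto k·j moves r onto δ + k·j (mod N), where δ is the offset from p to r.
  hub-rotation : ∀ k → N ≤ k * k → ∀ (p r : Fin N) →
                 ∃ λ t → T (isHub k (toℕ (rotate t p))) × T (isHub k (toℕ (rotate t r)))
  hub-rotation k N≤k² p r with hub-offset {k = k} N≤k² (offset<N p r)
  ... | j , j<k , kj<N , δ+kj%N<k = t , p-hub , r-hub
    where
      δ : ℕ
      δ = offset p r
      b : Fin N
      b = fromℕ< kj<N
      t : ℕ
      t = offset p b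
      p↦b : rotate t p ≡ b
      p↦b = rotate-offset p b
      p-hub : T (isHub k (toℕ (rotate t p)))
      p-hub rewrite p↦b | toℕ-fromℕ< kj<N =
        T-∨-introʳ (anyBelow k (λ i → k * j ≡ᵇ i)) (anyBelow-intro (λ i → k * j ≡ᵇ k * i) j<k (≡⇒≡ᵇ (k * j) (k * j) refl))
      r↦δ+kj : toℕ (rotate t r) ≡ (δ + k * j) % N
      r↦δ+kj = begin
        toℕ (rotate t r)             ≡⟨ cong (toℕ ∘ rotate t) (rotate-offset p r) ⟨
        toℕ (rotate t (rotate δ p))  ≡⟨ cong toℕ (rotate-rotate t δ p) ⟩
        toℕ (rotate (t + δ) p)       ≡⟨ cong (λ s → toℕ (rotate s p)) (+-comm t δ) ⟩
        toℕ (rotate (δ + t) p)       ≡⟨ cong toℕ (rotate-rotate δ t p) ⟨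
        toℕ (rotate δ (rotate t p))  ≡⟨ cong (toℕ ∘ rotate δ) p↦b ⟩
        toℕ (rotate δ b)             ≡⟨ toℕ-rotate δ b ⟩
        (δ + toℕ b) % N              ≡⟨ cong (λ v → (δ + v) % N) (toℕ-fromℕ< kj<N) ⟩
        (δ + k * j) % N              ∎
        where open ≡-Reasoning
      r-hub : T (isHub k (toℕ (rotate t r)))
      r-hub rewrite r↦δ+kj =
        T-∨-introˡ _ (anyBelow-intro (λ i → (δ + k * j) % N ≡ᵇ i) δ+kj%N<k (≡⇒≡ᵇ ((δ + k * j) % N) _ refl))

numEdges≤count : ∀ {n} (G : Graph n) (p : Fin n × Fin n → Bool) → (∀ i j → Edge G i j → T (p (i , j))) →
                 numEdges G ≤ count p (cartesianProduct (allFin n) (allFin n))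
numEdges≤count {n} G p edge⇒p = ≤-trans (≤-reflexive (length-filter-T? _ pairs))
  (count-mono (λ (i , j) e → edge⇒p i j (to T-≡ (proj₂ (to (T-∧ {toℕ i <ᵇ toℕ j}) e)))) pairs)
  where
    pairs : List (Fin n × Fin n)
    pairs = cartesianProduct (allFin n) (allFin n)

module _ {N : ℕ} .{{_ : NonZero N}} where

  private
    vertices : List (Fin N)
    vertices = allFin N

  length-vertices : length vertices ≡ N
  length-vertices = length-tabulate _

  count-hullAdj : ∀ x → count (hullAdj x) vertices ≤ 2
  count-hullAdj x = ≤-trans (count-∨ _ _ vertices)
    (+-mono-≤ (count-≡ᵇ-injective toℕ-injective (toℕ (next x)) (allFin⁺ N))
              (count-≡ᵇ-injective (next-injective ∘ toℕ-injective) (toℕ x) (allFin⁺ N)))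

  count-isHub : ∀ k → count (λ y → isHub k (toℕ y)) vertices ≤ k + k
  count-isHub k = ≤-trans (count-∨ _ _ vertices)
    (+-mono-≤ (count-anyBelow (λ j y → toℕ y ≡ᵇ j) vertices
                 (λ j → count-≡ᵇ-injective toℕ-injective j (allFin⁺ N)) k)
              (count-anyBelow (λ j y → toℕ y ≡ᵇ k * j) vertices
                 (λ j → count-≡ᵇ-injective toℕ-injective (k * j) (allFin⁺ N)) k))

  numEdges-hubGraph : ∀ k → numEdges (hubGraph k) ≤ N * 2 + ((k + k) * N + N * (k + k))
  numEdges-hubGraph k = begin
    numEdges (hubGraph k)
      ≤⟨ numEdges≤count (hubGraph k) (λ xy → hull xy ∨ (hub₁ xy ∨ hub₂ xy)) edge⇒adjacent ⟩
    count (λ xy → hull xy ∨ (hub₁ xy ∨ hub₂ xy)) pairs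
      ≤⟨ count-∨ hull _ pairs ⟩
    count hull pairs + count (λ xy → hub₁ xy ∨ hub₂ xy) pairs
      ≤⟨ +-monoʳ-≤ (count hull pairs) (count-∨ hub₁ hub₂ pairs) ⟩
    count hull pairs + (count hub₁ pairs + count hub₂ pairs)
      ≤⟨ +-mono-≤ (count-cartesianProduct-rows hull 2 vertices vertices count-hullAdj)
                  (+-mono-≤ (≤-reflexive (count-cartesianProduct-proj₁ (λ y → isHub k (toℕ y)) vertices vertices))
                            (count-cartesianProduct-rows hub₂ (k + k) vertices vertices (λ _ → count-isHub k))) ⟩
    length vertices * 2 + (count (λ y → isHub k (toℕ y)) vertices * length vertices + length vertices * (k + k))
      ≤⟨ +-mono-≤ (≤-reflexive (cong (_* 2) length-vertices))
                  (+-mono-≤ (*-mono-≤ (count-isHub k) (≤-reflexive length-vertices))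
                            (≤-reflexive (cong (_* (k + k)) length-vertices))) ⟩
    N * 2 + ((k + k) * N + N * (k + k))  ∎
    where
      open ≤-Reasoning
      pairs : List (Fin N × Fin N)
      pairs = cartesianProduct vertices vertices
      hull hub₁ hub₂ : Fin N × Fin N → Bool
      hull (x , y) = hullAdj x y
      hub₁ (x , y) = isHub k (toℕ x)
      hub₂ (x , y) = isHub k (toℕ y)
      edge⇒adjacent : ∀ x y → Edge (hubGraph k) x y → T (hull (x , y) ∨ (hub₁ (x , y) ∨ hub₂ (x , y)))
      edge⇒adjacent x y e = proj₂ (to (T-∧ {not (toℕ x ≡ᵇ toℕ y)}) (from T-≡ e))

  hubGraph-sparse : ∀ k → 1 ≤ k → k * k ≤ 4 * N → numEdges (hubGraph k) ^ 2 ≤ 144 * N ^ 3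
  hubGraph-sparse k 1≤k k²≤4N = square≤144·cube {N} {k} 1≤k k²≤4N (numEdges-hubGraph k)

module _ {N : ℕ} .{{_ : NonZero N}} where

  drawn-cycle-on-hull : (H : Graph N) {ψ σ : Fin N → Fin N} →
    Injective _≡_ _≡_ ψ → Injective _≡_ _≡_ σ →
    (∀ u v x y → Edge H u v → Edge H x y → ¬ Cross (ψ u) (ψ v) (ψ x) (ψ y)) →
    (∀ {u v} → OnCycle σ u v → Edge H u v) →
    ∀ {u v} → OnCycle σ u v → ψ u ≢ ψ v → HullEdge (ψ u) (ψ v)
  drawn-cycle-on-hull H {ψ} {σ} ψ-injective σ-injective ψ-planar cycle-edge = on-hull
    where
      polygon-planar : ∀ i j i′ j′ → CycNext i j → CycNext i′ j′ → ¬ Cross (ψ (σ i)) (ψ (σ j)) (ψ (σ i′)) (ψ (σ j′))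
      polygon-planar i j i′ j′ i→j i′→j′ =
        ψ-planar _ _ _ _ (cycle-edge (i , j , i→j , inj₁ (refl , refl))) (cycle-edge (i′ , j′ , i′→j′ , inj₁ (refl , refl)))
      on-hull : ∀ {u v} → OnCycle σ u v → ψ u ≢ ψ v → HullEdge (ψ u) (ψ v)
      on-hull (i , j , i→j , inj₁ (refl , refl)) ψu≢ψv =
        polygon-edge-is-hull (σ-injective ∘ ψ-injective) i→j polygon-planar ψu≢ψv
      on-hull (i , j , i→j , inj₂ (refl , refl)) ψu≢ψv =
        hullEdge-sym (polygon-edge-is-hull (σ-injective ∘ ψ-injective) i→j polygon-planar (ψu≢ψv ∘ sym))

  hubGraph-universal : ∀ k → N ≤ k * k → UniversalO2 (hubGraph {N} k)
  hubGraph-universal k N≤k² H ((ψ , ψ-injective , ψ-planar) , (σ , σ-injective , a , b , c , d , _ , _ , _ , H-edges)) =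
    φ , φ-injective , edge-preserved , λ u v x y uv xy → ψ-planar u v x y uv xy ∘ cross-rotate⁻ t
    where
      rotation : ∃ λ t → T (isHub k (toℕ (rotate t (ψ a)))) × T (isHub k (toℕ (rotate t (ψ c))))
      rotation = hub-rotation k N≤k² (ψ a) (ψ c)
      t : ℕ
      t = proj₁ rotation
      φ : Fin N → Fin N
      φ = rotate t ∘ ψ
      φ-injective : Injective _≡_ _≡_ φ
      φ-injective = ψ-injective ∘ rotate-injective t
      edge-preserved : ∀ u v → Edge H u v → Edge (hubGraph k) (φ u) (φ v)
      edge-preserved u v uv = hubGraph-edge k (ψu≢ψv ∘ rotate-injective t) (reason (proj₁ (H-edges u v) uv))
        where
          ψu≢ψv : ψ u ≢ ψ v
          ψu≢ψv ψu≡ψv with ψ-injective ψu≡ψv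
          ... | refl with trans (sym uv) (Graph.irrefl H u)
          ...   | ()
          reason : OnCycle σ u v ⊎ SameEdge u v a b ⊎ SameEdge u v c d →
                   HullEdge (φ u) (φ v) ⊎ T (isHub k (toℕ (φ u))) ⊎ T (isHub k (toℕ (φ v)))
          reason (inj₁ cyc) = inj₁ (hullEdge-rotate t
            (drawn-cycle-on-hull H ψ-injective σ-injective ψ-planar (proj₂ (H-edges _ _) ∘ inj₁) cyc ψu≢ψv))
          reason (inj₂ (inj₁ (inj₁ (refl , refl)))) = inj₂ (inj₁ (proj₁ (proj₂ rotation)))
          reason (inj₂ (inj₁ (inj₂ (refl , refl)))) = inj₂ (inj₂ (proj₁ (proj₂ rotation)))
          reason (inj₂ (inj₂ (inj₁ (refl , refl)))) = inj₂ (inj₁ (proj₂ (proj₂ rotation)))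
          reason (inj₂ (inj₂ (inj₂ (refl , refl)))) = inj₂ (inj₂ (proj₂ (proj₂ rotation)))

emptyGraph : Graph 0
emptyGraph = record { adj = λ () ; sym = λ () ; irrefl = λ () }

universal-on-empty : (G : Graph 0) → UniversalO2 G
universal-on-empty G H _ = (λ ()) , (λ {x} _ → ⊥-elim (¬Fin0 x)) , (λ ()) , (λ ())

theorem3 : Σ ℕ λ C → (n : ℕ) → Σ (Graph n) λ G →
    (numEdges G ^ 2 ≤ C * n ^ 3) × UniversalO2 G
theorem3 = 144 , construction
  where
    construction : (n : ℕ) → Σ (Graph n) λ G → (numEdges G ^ 2 ≤ 144 * n ^ 3) × UniversalO2 G
    construction zero = emptyGraph , z≤n , universal-on-empty emptyGraph
    construction (suc m) with square-bracket (suc m)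
    ... | k , N≤k² , k²≤4N = hubGraph k , hubGraph-sparse k (≤-square⇒positive N≤k²) k²≤4N , hubGraph-universal k N≤k²
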